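{- Let $T$ be a tree with burning number $b(T)=m$. Suppose that for every optimal burning sequence $(x_1,\dots,x_m)$ of $T$ the following two conditions hold: (1) the associated neighbourhoods $N_{m-1}[x_1],N_{m-2}[x_2],\dots,N_0[x_m]$ are mutually non-overlapping (pairwise disjoint); (2) every leaf of $T$ is burned in the last round, i.e. $\min_{1\le i\le m}\bigl(i+d(u,x_i)\bigr)=m$ for every leaf $u$ of $T$. Then $T$ is maximally $m$-burnable.
   Context: All graphs are finite, simple, undirected. $d(u,v)$ is the distance in the graph and $N_k[v]=\{u: d(u,v)\le k\}$. A sequence $(x_1,\dots,x_m)$ of vertices of a graph $G$ is a burning sequence of $G$ if $N_{m-1}[x_1]\cup N_{m-2}[x_2]\cup\cdots\cup N_0[x_m]=V(G)$ and $d(x_i,x_j)\ge j-i$ for all $i<j$ (this models choosing $x_i$ as a new fire source in round $i$, fire spreading to all neighbours of burned vertices each round; the vertex $u$ becomes burned in round $\min_i(i+d(u,x_i))$). The burning number $b(G)$ is the least length of a burning sequence; $G$ is $m$-burnable if $b(G)\le m$; a burning sequence of length $b(G)$ is optimal. $N_{m-i}[x_i]$ is the neighbourhood associated to $x_i$. In a tree, a leaf is a vertex of degree one, a branch vertex is a vertex of degree at least three, an arm is a path from a branch vertex to a leaf with no branch vertex in between, and an internal path is a path between two branch vertices with no other branch vertex in between. A tree $T$ with $b(T)=m$ is maximally $m$-burnable if every tree obtained from $T$ by inserting one new vertex into one of its arms or internal paths (i.e. subdividing one edge of an arm or internal path) is not $m$-burnable. -}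

module Defs where

open import Data.Nat using (ℕ; zero; suc; _≤_; _<_; _∸_)
open import Data.Fin using (Fin; zero; suc; toℕ; inject₁; fromℕ)
open import Data.Maybe using (Maybe; just; nothing)
import Data.Maybe as Maybe
open import Data.Product using (Σ; ∃; ∃-syntax; _×_; _,_)
open import Data.Sum using (_⊎_)
open import Data.Empty using (⊥)
open import Relation.Nullary using (¬_)
open import Relation.Binary.PropositionalEquality using (_≡_; _≢_)
open import Function.Definitions using (Injective)

record Graph : Set₁ where
  field
    n      : ℕ
    Adj    : Fin n → Fin n → Set
    sym    : ∀ {u v} → Adj u v → Adj v u
    irrefl : ∀ {u} → ¬ Adj u u

open Graph public

V : Graph → Set
V G = Fin (n G)

data Walk (G : Graph) : ℕ → V G → V G → Set where
  here : ∀ {u} → Walk G zero u u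
  step : ∀ {l u v w} → Adj G u v → Walk G l v w → Walk G (suc l) u w

DistLe : (G : Graph) → ℕ → V G → V G → Set
DistLe G k u v = ∃[ l ] (l ≤ k × Walk G l u v)

DistGe : (G : Graph) → ℕ → V G → V G → Set
DistGe G k u v = ∀ l → Walk G l u v → k ≤ l

Connected : Graph → Set
Connected G = ∀ u v → ∃[ l ] Walk G l u v

HasCycle : Graph → Set
HasCycle G = ∃[ k ] Σ (Fin (suc (suc (suc k))) → V G) λ c →
  Injective _≡_ _≡_ c
  × (∀ (i : Fin (suc (suc k))) → Adj G (c (inject₁ i)) (c (suc i)))
  × Adj G (c (fromℕ (suc (suc k)))) (c zero)

IsTree : Graph → Set
IsTree G = Fin (n G) × Connected G × ¬ HasCycle G   -- nonempty, connected, acyclic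

Leaf : (G : Graph) → V G → Set
Leaf G u = ∃[ v ] (Adj G u v × (∀ w → Adj G u w → w ≡ v))

Branch : (G : Graph) → V G → Set
Branch G u = ∃[ a ] ∃[ b ] ∃[ c ]
  (Adj G u a × Adj G u b × Adj G u c × a ≢ b × a ≢ c × b ≢ c)

IsPath : (G : Graph) (k : ℕ) → (Fin (suc k) → V G) → Set
IsPath G k p = Injective _≡_ _≡_ p × (∀ (i : Fin k) → Adj G (p (inject₁ i)) (p (suc i)))

NoBranchInside : (G : Graph) (k : ℕ) → (Fin (suc k) → V G) → Set
NoBranchInside G k p = ∀ (j : Fin (suc k)) → j ≢ zero → j ≢ fromℕ k → ¬ Branch G (p j)

IsArm : (G : Graph) (k : ℕ) → (Fin (suc k) → V G) → Set
IsArm G k p = IsPath G k p × Branch G (p zero) × Leaf G (p (fromℕ k)) × NoBranchInside G k p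

IsInternalPath : (G : Graph) (k : ℕ) → (Fin (suc k) → V G) → Set
IsInternalPath G k p = IsPath G k p × Branch G (p zero) × Branch G (p (fromℕ k)) × NoBranchInside G k p

-- radius of the neighbourhood of the (i+1)-th source (0-indexed i) in a
-- sequence of length m : m - (i+1)
radius : (m : ℕ) → Fin m → ℕ
radius m i = m ∸ suc (toℕ i)

IsBurningSeq : (G : Graph) (m : ℕ) → (Fin m → V G) → Set
IsBurningSeq G m x =
  (∀ u → ∃[ i ] DistLe G (radius m i) (x i) u)
  × (∀ (i j : Fin m) → toℕ i < toℕ j → DistGe G (toℕ j ∸ toℕ i) (x i) (x j))

BurningNumber : Graph → ℕ → Set
BurningNumber G m =
  (Σ (Fin m → V G) (IsBurningSeq G m))
  × (∀ m' (x : Fin m' → V G) → IsBurningSeq G m' x → m ≤ m')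

Burnable : Graph → ℕ → Set
Burnable G m = ∃[ m' ] (m' ≤ m × Σ (Fin m' → V G) (IsBurningSeq G m'))

NonOverlapping : (G : Graph) (m : ℕ) → (Fin m → V G) → Set
NonOverlapping G m x = ∀ (i j : Fin m) → i ≢ j →
  ¬ (∃[ u ] (DistLe G (radius m i) (x i) u × DistLe G (radius m j) (x j) u))

-- u is burned in round m: min_i (i + d(u, x_i)) = m  (1-indexed i), i.e.
-- every i has i + d(u,x_i) ≥ m and some i has i + d(u,x_i) ≤ m
BurnedInRound : (G : Graph) (m : ℕ) → (Fin m → V G) → V G → Set
BurnedInRound G m x u =
  (∀ i → DistGe G (radius m i) (x i) u) × (∃[ i ] DistLe G (radius m i) (x i) u)

-- Subdividing the edge {a,b}: the new vertex is the last element of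
-- Fin (suc n); old vertex v is inject₁ v.

toOld : ∀ {n} → Fin (suc n) → Maybe (Fin n)
toOld {zero}  zero    = nothing
toOld {suc n} zero    = just zero
toOld {suc n} (suc i) = Maybe.map suc (toOld i)

SubAdj : (G : Graph) → V G → V G → Maybe (V G) → Maybe (V G) → Set
SubAdj G a b (just u) (just v) = Adj G u v × ¬ ((u ≡ a × v ≡ b) ⊎ (u ≡ b × v ≡ a))
SubAdj G a b (just u) nothing  = u ≡ a ⊎ u ≡ b
SubAdj G a b nothing  (just v) = v ≡ a ⊎ v ≡ b
SubAdj G a b nothing  nothing  = ⊥

private
  SubAdj-sym : ∀ G a b x y → SubAdj G a b x y → SubAdj G a b y x
  SubAdj-sym G a b (just u) (just v) (e , ne) =
    Graph.sym G e , λ { (Data.Sum.inj₁ (p , q)) → ne (Data.Sum.inj₂ (q , p))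
                      ; (Data.Sum.inj₂ (p , q)) → ne (Data.Sum.inj₁ (q , p)) }
  SubAdj-sym G a b (just u) nothing  h = h
  SubAdj-sym G a b nothing  (just v) h = h
  SubAdj-sym G a b nothing  nothing  ()

  SubAdj-irr : ∀ G a b x → ¬ SubAdj G a b x x
  SubAdj-irr G a b (just u) (e , _) = Graph.irrefl G e
  SubAdj-irr G a b nothing ()

subdivide : (G : Graph) → V G → V G → Graph
subdivide G a b = record
  { n      = suc (n G)
  ; Adj    = λ x y → SubAdj G a b (toOld x) (toOld y)
  ; sym    = λ {x} {y} → SubAdj-sym G a b (toOld x) (toOld y)
  ; irrefl = λ {x} → SubAdj-irr G a b (toOld x)
  }

MaximallyBurnable : Graph → ℕ → Set
MaximallyBurnable T m =
  BurningNumber T m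
  × (∀ k (p : Fin (suc k) → V T) → (IsArm T k p ⊎ IsInternalPath T k p) →
       ∀ (i : Fin k) → ¬ Burnable (subdivide T (p (inject₁ i)) (p (suc i))) m)

{-# OPTIONS --safe #-}
-- Subdivide an edge ab of T by a new vertex w and suppose the resulting tree T′ is m-burnable.
-- Contracting w onto a turns (a padding of) a burning sequence of T′ into a sequence x whose
-- balls still cover T.  As b(T) = m and optimal sequences have disjoint balls, every covering
-- sequence of length m is a burning sequence: a source already burned when lit could be relit
-- just outside the burned region, producing an optimal sequence with overlapping balls.  So the
-- balls of x are disjoint and all leaves burn in round m; by disjointness each ball of x lies,
-- on old vertices, inside the T′-ball of the same source.  Walk from the source whose ball contains w across ab and
-- onwards: one meets either a leaf burned too early, or a vertex at T-distance exactly the radius,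
-- which the detour through w puts just outside the T′-ball.
module Submission where

open import Defs hiding (sym)
open import Data.Nat using (ℕ; zero; suc; _+_; _∸_; _≤_; _<_; _≤′_; ≤′-refl; ≤′-step; z≤n; s≤s; _≟_)
open import Data.Nat.Properties
open import Data.Fin using (Fin; zero; suc; toℕ; inject₁; inject≤; fromℕ; fromℕ<) renaming (_≟_ to _≟ᶠ_)
open import Data.Fin.Properties using (toℕ-injective; toℕ<n; toℕ-inject≤; toℕ-fromℕ<)
open import Data.Vec.Functional using (updateAt; _∷_)
open import Data.Vec.Functional.Properties using (updateAt-updates; updateAt-minimal; updateAt-id-local)
open import Data.Maybe using (Maybe; just; nothing; fromMaybe)
import Data.Maybe as Maybe
open import Data.Product using (Σ; ∃; ∃-syntax; _×_; _,_; proj₁; proj₂)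
open import Data.Sum using (_⊎_; inj₁; inj₂; swap; [_,_]′)
open import Data.Empty using (⊥; ⊥-elim)
open import Function using (_∘_; const)
open import Relation.Nullary using (¬_; Dec; yes; no; ¬¬-excluded-middle)
open import Relation.Nullary.Decidable using (_×-dec_; _⊎-dec_)
open import Relation.Binary.Definitions using (tri<; tri≈; tri>)
open import Relation.Binary.PropositionalEquality
  using (_≡_; _≢_; refl; sym; trans; cong; subst; subst₂; module ≡-Reasoning)

¬¬-∀-Fin : ∀ {n} {Q : Fin n → Set} → (∀ i → ¬ ¬ Q i) → ¬ ¬ (∀ i → Q i)
¬¬-∀-Fin {zero}  _ k = k λ ()
¬¬-∀-Fin {suc n} h k = h zero λ q₀ → ¬¬-∀-Fin (h ∘ suc) λ qs → k λ { zero → q₀ ; (suc i) → qs i }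

m∸n≡suc[m∸1+n] : ∀ {m n} → n < m → m ∸ n ≡ suc (m ∸ suc n)
m∸n≡suc[m∸1+n] n<m = +-∸-assoc 1 n<m

∸-telescope : ∀ {i j k} → i ≤ j → j ≤ k → (j ∸ i) + (k ∸ j) ≡ k ∸ i
∸-telescope {i} {j} {k} i≤j j≤k = begin
  (j ∸ i) + (k ∸ j)  ≡⟨ +-comm (j ∸ i) (k ∸ j) ⟩
  (k ∸ j) + (j ∸ i)  ≡⟨ +-∸-assoc (k ∸ j) i≤j ⟨
  (k ∸ j) + j ∸ i    ≡⟨ cong (_∸ i) (m∸n+n≡m j≤k) ⟩
  k ∸ i              ∎
  where open ≡-Reasoning

radius-nested : ∀ {j p m} → j < p → p < m → (p ∸ suc j) + (m ∸ suc p) ≤ m ∸ suc j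
radius-nested {j} {p} {m} j<p p<m = begin
  (p ∸ suc j) + (m ∸ suc p)  ≤⟨ +-monoʳ-≤ (p ∸ suc j) (∸-monoʳ-≤ m (n≤1+n p)) ⟩
  (p ∸ suc j) + (m ∸ p)      ≡⟨ ∸-telescope j<p (<⇒≤ p<m) ⟩
  m ∸ suc j                  ∎
  where open ≤-Reasoning

module _ {G : Graph} where

  infixr 5 _++ʷ_
  _++ʷ_ : ∀ {l l′ u v w} → Walk G l u v → Walk G l′ v w → Walk G (l + l′) u w
  here     ++ʷ q = q
  step e p ++ʷ q = step e (p ++ʷ q)

  _∷ʳʷ_ : ∀ {l u v w} → Walk G l u v → Adj G v w → Walk G (suc l) u w
  here     ∷ʳʷ e = step e here
  step e p ∷ʳʷ e′ = step e (p ∷ʳʷ e′)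

  reverseʷ : ∀ {l u v} → Walk G l u v → Walk G l v u
  reverseʷ here       = here
  reverseʷ (step e p) = reverseʷ p ∷ʳʷ Graph.sym G e

  distLe-refl : ∀ {k u} → DistLe G k u u
  distLe-refl = 0 , z≤n , here

  distLe-mono : ∀ {k k′ u v} → k ≤ k′ → DistLe G k u v → DistLe G k′ u v
  distLe-mono k≤k′ (l , l≤k , w) = l , ≤-trans l≤k k≤k′ , w

  distLe-trans : ∀ {k k′ u v w} → DistLe G k u v → DistLe G k′ v w → DistLe G (k + k′) u w
  distLe-trans (l , l≤k , p) (l′ , l′≤k′ , q) = l + l′ , +-mono-≤ l≤k l′≤k′ , p ++ʷ q

  distLe-step : ∀ {k u v w} → Adj G u v → DistLe G k v w → DistLe G (suc k) u w
  distLe-step e (l , l≤k , p) = suc l , s≤s l≤k , step e p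

  distLe-∷ʳ : ∀ {k u v w} → DistLe G k u v → Adj G v w → DistLe G (suc k) u w
  distLe-∷ʳ (l , l≤k , p) e = suc l , s≤s l≤k , p ∷ʳʷ e

  distGe≤distLe : ∀ {k j u v} → DistGe G k u v → DistLe G j u v → k ≤ j
  distGe≤distLe ge (l , l≤j , w) = ≤-trans (ge l w) l≤j

  distGe-intro : ∀ {k u v} → (∀ {l} → Walk G l u v → l < k → ⊥) → DistGe G k u v
  distGe-intro no-short l w = ≮⇒≥ (no-short w)

  exact-distance : ∀ {N u v} → DistLe G N u v → ¬ ¬ (∃[ e ] (e ≤ N × DistLe G e u v × DistGe G e u v))
  exact-distance {zero} d k = k (0 , z≤n , d , λ _ _ → z≤n)
  exact-distance {suc N} {u} {v} d k = ¬¬-excluded-middle {A = DistLe G N u v} λ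
    { (yes d′) → exact-distance d′ λ (e , e≤N , de , ge) → k (e , m≤n⇒m≤1+n e≤N , de , ge)
    ; (no ¬d′) → k (suc N , ≤-refl , d , distGe-intro λ w l<1+N → ¬d′ (_ , ≤-pred l<1+N , w))
    }

  shortest-walk : ∀ {l u v} → Walk G l u v → ¬ ¬ (∃[ L ] (Walk G L u v × DistGe G L u v))
  shortest-walk w k = exact-distance (_ , ≤-refl , w) λ (e , _ , (L , L≤e , w′) , ge) →
    k (L , w′ , λ l w″ → ≤-trans L≤e (ge l w″))

  vertex : ∀ {l u v} → Walk G l u v → Fin (suc l) → V G
  vertex {u = u} _ zero    = u
  vertex (step _ w) (suc i) = vertex w i

  vertex-adjacent : ∀ {l u v} (w : Walk G l u v) (i : Fin l) → Adj G (vertex w (inject₁ i)) (vertex w (suc i))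
  vertex-adjacent (step e _) zero    = e
  vertex-adjacent (step _ w) (suc i) = vertex-adjacent w i

  vertex-last : ∀ {l u v} (w : Walk G l u v) → vertex w (fromℕ l) ≡ v
  vertex-last here       = refl
  vertex-last (step _ w) = vertex-last w

  takeʷ : ∀ {l u v} (w : Walk G l u v) (i : Fin (suc l)) → Walk G (toℕ i) u (vertex w i)
  takeʷ _ zero             = here
  takeʷ (step e w) (suc i) = step e (takeʷ w i)

  dropʷ : ∀ {l u v} (w : Walk G l u v) (i : Fin (suc l)) → Walk G (l ∸ toℕ i) (vertex w i) v
  dropʷ w zero             = w
  dropʷ (step _ w) (suc i) = dropʷ w i

  shortest-no-repeat : ∀ {L u v} (w : Walk G L u v) → DistGe G L u v →
                       ∀ {i j} → toℕ i < toℕ j → vertex w i ≢ vertex w j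
  shortest-no-repeat {L} w shortest {i} {j} i<j eq = <⇒≱ shorter (shortest _ loopless)
    where
    loopless : Walk G (toℕ i + (L ∸ toℕ j)) _ _
    loopless = takeʷ w i ++ʷ subst (λ s → Walk G (L ∸ toℕ j) s _) (sym eq) (dropʷ w j)
    shorter : toℕ i + (L ∸ toℕ j) < L
    shorter = subst (toℕ i + (L ∸ toℕ j) <_) (m+[n∸m]≡n (≤-pred (toℕ<n j))) (+-monoˡ-< (L ∸ toℕ j) i<j)

  shortest-injective : ∀ {L u v} (w : Walk G L u v) → DistGe G L u v →
                       ∀ {i j} → vertex w i ≡ vertex w j → i ≡ j
  shortest-injective w shortest {i} {j} eq with <-cmp (toℕ i) (toℕ j)
  ... | tri< i<j _ _ = ⊥-elim (shortest-no-repeat w shortest i<j eq)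
  ... | tri≈ _ i≡j _ = toℕ-injective i≡j
  ... | tri> _ _ j<i = ⊥-elim (shortest-no-repeat w shortest j<i (sym eq))

-- The same shape as the pair excluded in SubAdj, so old edges of subdivide T a b are edges of removeEdge T a b.
EdgeEnds : {A : Set} → A → A → A → A → Set
EdgeEnds c d x y = (x ≡ c × y ≡ d) ⊎ (x ≡ d × y ≡ c)

edgeEnds-flip : ∀ {A : Set} {c d x y : A} → EdgeEnds c d x y → EdgeEnds c d y x
edgeEnds-flip (inj₁ (x≡c , y≡d)) = inj₂ (y≡d , x≡c)
edgeEnds-flip (inj₂ (x≡d , y≡c)) = inj₁ (y≡c , x≡d)

edgeEnds-trans : ∀ {A : Set} {a b c d x y : A} → EdgeEnds a b c d → EdgeEnds c d x y → EdgeEnds a b x y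
edgeEnds-trans (inj₁ (refl , refl)) xy = xy
edgeEnds-trans (inj₂ (refl , refl)) xy = swap xy

edgeEnds-endpoint : ∀ {A : Set} {a b c d x : A} → EdgeEnds a b c d → x ≡ a ⊎ x ≡ b → x ≡ c ⊎ x ≡ d
edgeEnds-endpoint (inj₁ (refl , refl)) x≡ = x≡
edgeEnds-endpoint (inj₂ (refl , refl)) x≡ = swap x≡

edgeEnds-adj : ∀ (G : Graph) {a b c d} → EdgeEnds a b c d → Adj G a b → Adj G c d
edgeEnds-adj G (inj₁ (refl , refl)) e = e
edgeEnds-adj G (inj₂ (refl , refl)) e = Graph.sym G e

edgeEnds? : ∀ {n} (c d x y : Fin n) → Dec (EdgeEnds c d x y)
edgeEnds? c d x y = ((x ≟ᶠ c) ×-dec (y ≟ᶠ d)) ⊎-dec ((x ≟ᶠ d) ×-dec (y ≟ᶠ c))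

removeEdge : (G : Graph) → V G → V G → Graph
removeEdge G c d = record
  { n      = n G
  ; Adj    = λ x y → Adj G x y × ¬ EdgeEnds c d x y
  ; sym    = λ (e , ¬cd) → Graph.sym G e , ¬cd ∘ edgeEnds-flip
  ; irrefl = λ (e , _) → Graph.irrefl G e
  }

-- z is on x's side of the edge cd, where x is c or d.
Side : (G : Graph) (c d x z : V G) → Set
Side G c d x z = ∃[ l ] Walk (removeEdge G c d) l x z

module _ {G : Graph} {c d : V G} where

  side-step : ∀ {x s s₁} → Side G c d x s → Adj (removeEdge G c d) s s₁ → Side G c d x s₁
  side-step (l , w) e = suc l , w ∷ʳʷ e

  side-swap : ∀ {x z} → Side G c d x z → Side G d c x z
  side-swap (l , w) = l , swapʷ w
    where
    swapʷ : ∀ {l u v} → Walk (removeEdge G c d) l u v → Walk (removeEdge G d c) l u v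
    swapʷ here              = here
    swapʷ (step (e , ¬cd) w) = step (e , ¬cd ∘ swap) (swapʷ w)

  sides-cover : Connected G → ∀ z → Side G c d c z ⊎ Side G c d d z
  sides-cover conn z = along (proj₂ (conn c z)) (inj₁ (0 , here))
    where
    along : ∀ {l s z} → Walk G l s z → Side G c d c s ⊎ Side G c d d s → Side G c d c z ⊎ Side G c d d z
    along here side = side
    along (step {u = s} {v = s₁} e w) side with edgeEnds? c d s s₁
    ... | yes (inj₁ (_ , refl)) = along w (inj₂ (0 , here))
    ... | yes (inj₂ (_ , refl)) = along w (inj₁ (0 , here))
    ... | no ¬cd with side
    ...   | inj₁ sc = along w (inj₁ (side-step sc (e , ¬cd)))
    ...   | inj₂ sd = along w (inj₂ (side-step sd (e , ¬cd)))

module Acyclic (T : Graph) (acyclic : ¬ HasCycle T) where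

  bridge : ∀ {c d l} → Adj T c d → ¬ Walk (removeEdge T c d) l c d
  bridge {c} {d} e w = shortest-walk w λ (_ , w′ , shortest) → closes-cycle w′ shortest
    where
    closes-cycle : ∀ {L} (w : Walk (removeEdge T c d) L c d) → DistGe (removeEdge T c d) L c d → ⊥
    closes-cycle here                  _        = Graph.irrefl T e
    closes-cycle (step (_ , ¬cd) here) _        = ¬cd (inj₁ (refl , refl))
    closes-cycle {suc (suc k)} w       shortest = acyclic
      ( k , vertex w , shortest-injective w shortest
      , (λ i → proj₁ (vertex-adjacent w i))
      , subst (λ z → Adj T z c) (sym (vertex-last w)) (Graph.sym T e) )

  sides-disjoint : ∀ {c d z} → Adj T c d → Side T c d c z → Side T c d d z → ⊥
  sides-disjoint e (_ , wc) (_ , wd) = bridge e (wc ++ʷ reverseʷ wd)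

  crossing : ∀ {c d l s z} → Adj T c d → Walk T l s z → Side T c d c s → Side T c d d z →
             ∃[ l₁ ] ∃[ l₂ ] (suc (l₁ + l₂) ≤ l × Walk T l₁ s c × Walk T l₂ d z)
  crossing e here sc sd = ⊥-elim (sides-disjoint e sc sd)
  crossing {c} {d} e (step {u = s} {v = s₁} e₁ w) sc sd with edgeEnds? c d s s₁
  ... | yes (inj₁ (refl , refl)) = 0 , _ , ≤-refl , here , w
  ... | yes (inj₂ (refl , _))    = ⊥-elim (sides-disjoint e sc (0 , here))
  ... | no ¬cd =
    let (l₁ , l₂ , l₁+l₂<l , w₁ , w₂) = crossing e w (side-step sc (e₁ , ¬cd)) sd
    in suc l₁ , l₂ , s≤s l₁+l₂<l , step e₁ w₁ , w₂

  crossing-distGe : ∀ {c d s z e t} → Adj T c d → Side T c d c s → Side T c d d z →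
                    DistGe T e s c → DistGe T t d z → DistGe T (suc (e + t)) s z
  crossing-distGe cd sc sd ge₁ ge₂ l w =
    let (l₁ , l₂ , l₁+l₂<l , w₁ , w₂) = crossing cd w sc sd
    in ≤-trans (s≤s (+-mono-≤ (ge₁ l₁ w₁) (ge₂ l₂ w₂))) l₁+l₂<l

  side-nested : ∀ {c d d′ z} → Adj T c d → Adj T d d′ → d′ ≢ c → Side T d d′ d′ z → Side T c d d z
  side-nested {c} {d} {d′} cd dd′ d′≢c (l , w) = suc l , step (dd′ , leaves-d) (stays-beyond w (0 , here))
    where
    not-d : ∀ {x} → Side T d d′ d′ x → x ≢ d
    not-d sx refl = sides-disjoint dd′ (0 , here) sx
    leaves-d : ¬ EdgeEnds c d d d′
    leaves-d (inj₁ (d≡c , _)) = Graph.irrefl T (subst (λ x → Adj T x d) (sym d≡c) cd)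
    leaves-d (inj₂ (_ , d′≡c)) = d′≢c d′≡c
    stays-beyond : ∀ {l s z} → Walk (removeEdge T d d′) l s z → Side T d d′ d′ s → Walk (removeEdge T c d) l s z
    stays-beyond here _ = here
    stays-beyond (step {v = s₁} (e , ¬dd′) w) ss =
      let ss₁ = side-step ss (e , ¬dd′) in
      step (e , λ { (inj₁ (_ , s₁≡d)) → not-d ss₁ s₁≡d ; (inj₂ (s≡d , _)) → not-d ss s≡d })
           (stays-beyond w ss₁)

  far-vertex-or-near-leaf : ∀ t {c d} → Adj T c d →
        ¬ ¬ ( (∃[ z ] (Side T c d d z × DistLe T t d z × DistGe T t d z))
            ⊎ (∃[ ℓ ] (Leaf T ℓ × Side T c d d ℓ × ∃[ j ] (j < t × Walk T j d ℓ))) )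
  far-vertex-or-near-leaf zero e k = k (inj₁ (_ , (0 , here) , distLe-refl , λ _ _ → z≤n))
  far-vertex-or-near-leaf (suc t) {c} {d} cd k = ¬¬-excluded-middle {A = ∃[ d′ ] (Adj T d d′ × d′ ≢ c)} λ
    { (yes (d′ , dd′ , d′≢c)) → far-vertex-or-near-leaf t dd′ λ
        { (inj₁ (z , sz , dle , dge)) → k (inj₁ (z , side-nested cd dd′ d′≢c sz ,
              distLe-step dd′ dle , crossing-distGe dd′ (0 , here) sz (λ _ _ → z≤n) dge))
        ; (inj₂ (ℓ , leaf , sℓ , j , j<t , w)) → k (inj₂ (ℓ , leaf , side-nested cd dd′ d′≢c sℓ ,
              suc j , s≤s j<t , step dd′ w))
        }
    ; (no no-way-on) → k (inj₂ (d , (c , Graph.sym T cd , only-c no-way-on) , (0 , here) , 0 , s≤s z≤n , here))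
    }
    where
    only-c : ¬ (∃[ d′ ] (Adj T d d′ × d′ ≢ c)) → ∀ w → Adj T d w → w ≡ c
    only-c no-way-on w dw with w ≟ᶠ c
    ... | yes w≡c = w≡c
    ... | no  w≢c = ⊥-elim (no-way-on (w , dw , w≢c))

Covers : (G : Graph) (m : ℕ) → (Fin m → V G) → Set
Covers G m x = ∀ u → ∃[ i ] DistLe G (radius m i) (x i) u

-- radius (suc M) (suc i) reduces to radius M i, so a prepended source leaves the other balls unchanged.
covers-pad : ∀ {G M m} → M ≤′ m → V G → Σ (Fin M → V G) (Covers G M) → Σ (Fin m → V G) (Covers G m)
covers-pad ≤′-refl       _  cover = cover
covers-pad (≤′-step M≤m) v₀ cover =
  let (x , covers) = covers-pad M≤m v₀ cover in
  v₀ ∷ x , λ u → let (i , d) = covers u in suc i , d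

module CoveringIsBurning (G : Graph) (conn : Connected G) (m : ℕ)
  (optimal : ∀ m′ (x : Fin m′ → V G) → IsBurningSeq G m′ x → m ≤ m′)
  (nonOverlapping : ∀ (x : Fin m → V G) → IsBurningSeq G m x → NonOverlapping G m x) where

  Separated : ℕ → (Fin m → V G) → Set
  Separated p f = ∀ (i j : Fin m) → toℕ i < toℕ j → toℕ j < p → DistGe G (toℕ j ∸ toℕ i) (f i) (f j)

  -- The state after the first p rounds, in which the sources f i with toℕ i < p have been lit.
  Burned Unburned : ℕ → (Fin m → V G) → V G → Set
  Burned   p f v = ∃[ i ] (toℕ i < p × DistLe G (p ∸ suc (toℕ i)) (f i) v)
  Unburned p f v = ∀ i → toℕ i < p → DistGe G (p ∸ toℕ i) (f i) v

  burned-unburned : ∀ {p f v} → Burned p f v → Unburned p f v → ⊥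
  burned-unburned (i , i<p , d) ub =
    1+n≰n (≤-trans (≤-reflexive (sym (m∸n≡suc[m∸1+n] i<p))) (distGe≤distLe (ub i i<p) d))

  short-walk⇒burned : ∀ {p f v l} i → toℕ i < p → Walk G l (f i) v → l < p ∸ toℕ i → Burned p f v
  short-walk⇒burned {l = l} i i<p w short = i , i<p , l , ≤-pred (subst (l <_) (m∸n≡suc[m∸1+n] i<p) short) , w

  ¬unburned⇒burned : ∀ {p f v} → ¬ Unburned p f v → ¬ ¬ Burned p f v
  ¬unburned⇒burned ¬ub ¬burned = ¬ub λ i i<p → distGe-intro λ w short → ¬burned (short-walk⇒burned i i<p w short)

  prefix-burning : ∀ {p f} (p≤m : p ≤ m) → Separated p f → (∀ v → Burned p f v) →
                   IsBurningSeq G p (λ i → f (inject≤ i p≤m))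
  prefix-burning {p} {f} p≤m separated burned = covers , separated′
    where
    ι : Fin p → Fin m
    ι i = inject≤ i p≤m
    toℕ-ι : ∀ i → toℕ (ι i) ≡ toℕ i
    toℕ-ι i = toℕ-inject≤ i p≤m
    covers : Covers G p (f ∘ ι)
    covers v =
      let (i , i<p , d) = burned v
          ι-fromℕ< : ι (fromℕ< i<p) ≡ i
          ι-fromℕ< = toℕ-injective (trans (toℕ-ι _) (toℕ-fromℕ< i<p))
      in fromℕ< i<p , subst₂ (λ r x → DistLe G (p ∸ suc r) (f x) v) (sym (toℕ-fromℕ< i<p)) (sym ι-fromℕ<) d
    separated′ : ∀ (i j : Fin p) → toℕ i < toℕ j → DistGe G (toℕ j ∸ toℕ i) (f (ι i)) (f (ι j))
    separated′ i j i<j = subst₂ (λ a b → DistGe G (b ∸ a) (f (ι i)) (f (ι j))) (toℕ-ι i) (toℕ-ι j)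
      (separated (ι i) (ι j) (subst₂ _<_ (sym (toℕ-ι i)) (sym (toℕ-ι j)) i<j)
                             (subst (_< p) (sym (toℕ-ι j)) (toℕ<n j)))

  some-unburned : ∀ {p f} → p < m → Separated p f → ¬ ¬ ∃ (Unburned p f)
  some-unburned p<m separated none =
    ¬¬-∀-Fin (λ v → ¬unburned⇒burned λ ub → none (v , ub)) λ burned →
    <⇒≱ p<m (optimal _ _ (prefix-burning (<⇒≤ p<m) separated burned))

  frontier : ∀ {p f l s t} → Walk G l s t → Burned p f s → Unburned p f t →
             ¬ ¬ (∃[ v ] ∃[ v′ ] (Adj G v v′ × Burned p f v × Unburned p f v′))
  frontier here bs ut _ = burned-unburned bs ut
  frontier {p} {f} (step {v = s₁} e w) bs ut k = ¬¬-excluded-middle {A = Unburned p f s₁} λ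
    { (yes u₁)  → k (_ , s₁ , e , bs , u₁)
    ; (no ¬u₁) → ¬unburned⇒burned ¬u₁ λ b₁ → frontier w b₁ ut k
    }

  relight : (Fin m → V G) → Fin m → V G → Fin m → V G
  relight f P u = updateAt f P (const u)

  relight-below : ∀ {f P u} i → toℕ i < toℕ P → relight f P u i ≡ f i
  relight-below {f} {P} i i<P = updateAt-minimal i P f λ { refl → <-irrefl refl i<P }

  separated-relight : ∀ {p f u} P → toℕ P ≡ p → Separated p f → Unburned p f u → Separated (suc p) (relight f P u)
  separated-relight {f = f} {u} P refl separated ub i j i<j j≤P with j ≟ᶠ P
  ... | yes refl = subst₂ (DistGe G (toℕ P ∸ toℕ i)) (sym (relight-below i i<j)) (sym (updateAt-updates P f))
                     (ub i i<j)
  ... | no j≢P = subst₂ (DistGe G (toℕ j ∸ toℕ i))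
                   (sym (relight-below i (<-trans i<j j<P))) (sym (relight-below j j<P))
                   (separated i j i<j j<P)
    where
    j<P : toℕ j < toℕ P
    j<P = ≤∧≢⇒< (≤-pred j≤P) (j≢P ∘ toℕ-injective)

  -- A source that is already burned when it is lit has its ball inside an earlier source's ball.
  covers-relight : ∀ {p f u} P → toℕ P ≡ p → p < m → Covers G m f → Burned p f (f P) → Covers G m (relight f P u)
  covers-relight {f = f} P refl P<m covers (j , j<P , dj) v with covers v
  ... | i , d with i ≟ᶠ P
  ...   | no i≢P = i , subst (λ x → DistLe G (radius m i) x v) (sym (updateAt-minimal i P f i≢P)) d
  ...   | yes refl = j , subst (λ x → DistLe G (radius m j) x v) (sym (relight-below j j<P))
                           (distLe-mono (radius-nested j<P P<m) (distLe-trans dj d))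

  next-source : ∀ {p f} P → toℕ P ≡ p → p < m → Separated p f → Covers G m f →
                ¬ ¬ (∃[ u ] (Unburned p f u × Covers G m (relight f P u)))
  next-source {p} {f} P P≡p p<m separated covers k = ¬¬-excluded-middle {A = Unburned p f (f P)} λ
    { (yes ub) → k (f P , ub , λ v → let (i , d) = covers v in
                   i , subst (λ x → DistLe G (radius m i) x v) (sym (updateAt-id-local P f refl i)) d)
    ; (no ¬ub) → ¬unburned⇒burned ¬ub λ burned → some-unburned p<m separated λ (u , ub) →
                   k (u , ub , covers-relight P P≡p p<m covers burned)
    }

  complete-greedily : ∀ r {p f} → r + p ≡ m → Separated p f → Covers G m f →
             ¬ ¬ (∃[ g ] (IsBurningSeq G m g × (∀ i → toℕ i < p → g i ≡ f i)))
  complete-greedily zero {f = f} refl separated covers k =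
    k (f , (covers , λ i j i<j → separated i j i<j (toℕ<n j)) , λ _ _ → refl)
  complete-greedily (suc r) {p} {f} r+p≡m separated covers k =
    next-source P P≡p p<m separated covers λ (u , ub , covers′) →
    complete-greedily r (trans (+-suc r p) r+p≡m) (separated-relight P P≡p separated ub) covers′
      λ (g , burning , agrees) →
    k (g , burning , λ i i<p →
      trans (agrees i (m≤n⇒m≤1+n i<p)) (relight-below i (subst (toℕ i <_) (sym P≡p) i<p)))
    where
    p<m : p < m
    p<m = subst (p <_) r+p≡m (s≤s (m≤n+m p r))
    P : Fin m
    P = fromℕ< p<m
    P≡p : toℕ P ≡ p
    P≡p = toℕ-fromℕ< p<m

  -- Relighting P just beyond the burned region and completing greedily would give an optimal
  -- sequence whose balls overlap at the new source.
  source-unburned : ∀ {f} P → Covers G m f → Separated (toℕ P) f → ¬ Burned (toℕ P) f (f P)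
  source-unburned {f} P covers separated burned =
    some-unburned (toℕ<n P) separated λ (u₀ , ub₀) →
    frontier (proj₂ (conn (f P) u₀)) burned ub₀ λ (v , v′ , e , (j , j<P , dj) , ub′) →
    complete-greedily (m ∸ suc (toℕ P)) (m∸n+n≡m (toℕ<n P)) (separated-relight P refl separated ub′)
             (covers-relight P refl (toℕ<n P) covers burned) λ (g , burning , agrees) →
    let gj≡fj = trans (agrees j (m≤n⇒m≤1+n j<P)) (relight-below j j<P)
        gP≡v′ = trans (agrees P ≤-refl) (updateAt-updates P f)
        j-reaches-v′ : DistLe G (radius m j) (g j) v′
        j-reaches-v′ = subst (λ x → DistLe G (radius m j) x v′) (sym gj≡fj)
          (distLe-mono (≤-trans (≤-reflexive (sym (m∸n≡suc[m∸1+n] j<P))) (∸-monoˡ-≤ (suc (toℕ j)) (toℕ<n P)))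
                       (distLe-∷ʳ dj e))
    in nonOverlapping g burning j P (λ { refl → <-irrefl refl j<P })
         (v′ , j-reaches-v′ , subst (λ x → DistLe G (radius m P) x v′) (sym gP≡v′) distLe-refl)

  covering-separated : ∀ {f} → Covers G m f → ∀ p → p ≤ m → Separated p f
  covering-separated covers zero    _     _ _ _   ()
  covering-separated {f} covers (suc p) 1+p≤m i j i<j j<1+p with toℕ j ≟ p
  ... | no j≢p = covering-separated covers p (<⇒≤ 1+p≤m) i j i<j (≤∧≢⇒< (≤-pred j<1+p) j≢p)
  ... | yes j≡p = distGe-intro λ w short →
    source-unburned j covers (subst (λ q → Separated q f) (sym j≡p) (covering-separated covers p (<⇒≤ 1+p≤m)))
      (short-walk⇒burned i i<j w short)

  covering⇒burning : ∀ {f} → Covers G m f → IsBurningSeq G m f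
  covering⇒burning covers = covers , λ i j i<j → covering-separated covers m ≤-refl i j i<j (toℕ<n j)

toOld-inject₁ : ∀ {n} (x : Fin n) → toOld (inject₁ x) ≡ just x
toOld-inject₁ {suc n} zero    = refl
toOld-inject₁ {suc n} (suc x) = cong (Maybe.map suc) (toOld-inject₁ x)

toOld-fromℕ : ∀ n → toOld (fromℕ n) ≡ nothing
toOld-fromℕ zero    = refl
toOld-fromℕ (suc n) = cong (Maybe.map suc) (toOld-fromℕ n)

module Subdivision {T : Graph} (acyclic : ¬ HasCycle T) {a b : V T} (ab : Adj T a b) where
  open Acyclic T acyclic

  T′ : Graph
  T′ = subdivide T a b

  new : V T′
  new = fromℕ (n T)

  -- Walks of T′ with vertices read through toOld, so that nothing stands for the new vertex.
  data SubWalk : ℕ → Maybe (V T) → Maybe (V T) → Set where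
    here : ∀ {x} → SubWalk 0 x x
    step : ∀ {l x y z} → SubAdj T a b x y → SubWalk l y z → SubWalk (suc l) x z

  toSubWalk : ∀ {l u v x y} → toOld u ≡ x → toOld v ≡ y → Walk T′ l u v → SubWalk l x y
  toSubWalk refl refl here       = here
  toSubWalk refl v≡y  (step e w) = step e (toSubWalk refl v≡y w)

  contract : Maybe (V T) → V T
  contract = fromMaybe a

  contract-walk : ∀ {l x y} → SubWalk l x y → DistLe T l (contract x) (contract y)
  contract-walk here                = distLe-refl
  contract-walk (step {x = x} {y} e w) = distLe-trans (contract-edge x y e) (contract-walk w)
    where
    contract-edge : ∀ x y → SubAdj T a b x y → DistLe T 1 (contract x) (contract y)
    contract-edge (just u) (just v) (e , _)    = 1 , ≤-refl , step e here
    contract-edge (just u) nothing  (inj₁ refl) = distLe-refl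
    contract-edge (just u) nothing  (inj₂ refl) = 1 , ≤-refl , step (Graph.sym T ab) here
    contract-edge nothing  (just v) (inj₁ refl) = distLe-refl
    contract-edge nothing  (just v) (inj₂ refl) = 1 , ≤-refl , step ab here

  project : ∀ {r u z} → DistLe T′ r u (inject₁ z) → DistLe T r (contract (toOld u)) z
  project {z = z} (l , l≤r , w) = distLe-mono l≤r (contract-walk (toSubWalk refl (toOld-inject₁ z) w))

  module Oriented {c d : V T} (cd-is-ab : EdgeEnds a b c d) where

    cd : Adj T c d
    cd = edgeEnds-adj T cd-is-ab ab

    new-neighbour : ∀ {x} → x ≡ a ⊎ x ≡ b → x ≡ c ⊎ x ≡ d
    new-neighbour = edgeEnds-endpoint cd-is-ab

    old-edge : ∀ {x y} → ¬ EdgeEnds a b x y → ¬ EdgeEnds c d x y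
    old-edge ¬ab = ¬ab ∘ edgeEnds-trans cd-is-ab

    shortcut-old : ∀ {l s z} → SubWalk l (just s) (just z) → Side T c d c s → Side T c d d z →
                   ∃[ l′ ] (l′ < l × Walk T l′ s z)
    shortcut-new : ∀ {l z} → SubWalk l nothing (just z) → Side T c d d z →
                   ∃[ l′ ] (l′ < l × Walk T l′ d z)

    shortcut-old here sc sd = ⊥-elim (sides-disjoint cd sc sd)
    shortcut-old (step {y = just s₁} (e , ¬ab) w) sc sd =
      let (l′ , l′<l , w′) = shortcut-old w (side-step sc (e , old-edge ¬ab)) sd
      in suc l′ , s≤s l′<l , step e w′
    shortcut-old (step {y = nothing} s-new w) sc sd with new-neighbour s-new
    ... | inj₂ refl = ⊥-elim (sides-disjoint cd sc (0 , here))
    ... | inj₁ refl = let (l′ , l′<l , w′) = shortcut-new w sd in suc l′ , s≤s l′<l , step cd w′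

    shortcut-new (step {y = just s₁} s₁-new w) sd with new-neighbour s₁-new
    ... | inj₂ refl = let (l′ , l′≤l , w′) = contract-walk w in l′ , s≤s l′≤l , w′
    ... | inj₁ refl =
      let (l′ , l′<l , w′) = shortcut-old w (0 , here) sd
          (l₁ , l₂ , l₁+l₂<l′ , _ , w₂) = crossing cd w′ (0 , here) sd
      in l₂ , m≤n⇒m≤1+n (≤-trans (≤-trans (s≤s (m≤n+m l₂ l₁)) l₁+l₂<l′) (<⇒≤ l′<l)) , w₂

    reach-new : ∀ {l s} → SubWalk l (just s) nothing → Side T c d c s → ∃[ l′ ] (l′ < l × Walk T l′ s c)
    reach-new (step {y = nothing} s-new _) sc with new-neighbour s-new
    ... | inj₁ refl = 0 , s≤s z≤n , here
    ... | inj₂ refl = ⊥-elim (sides-disjoint cd sc (0 , here))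
    reach-new (step {y = just s₁} (e , ¬ab) w) sc =
      let (l′ , l′<l , w′) = reach-new w (side-step sc (e , old-edge ¬ab))
      in suc l′ , s≤s l′<l , step e w′

module Maximality (T : Graph) (conn : Connected T) (acyclic : ¬ HasCycle T) (m : ℕ)
  (optimal : ∀ m′ (x : Fin m′ → V T) → IsBurningSeq T m′ x → m ≤ m′)
  (hyp : ∀ (x : Fin m → V T) → IsBurningSeq T m x →
         NonOverlapping T m x × (∀ u → Leaf T u → BurnedInRound T m x u)) where
  open Acyclic T acyclic
  open CoveringIsBurning T conn m optimal (λ x burning → proj₁ (hyp x burning))

  module _ {a b : V T} (ab : Adj T a b) where
    open Subdivision {T} acyclic ab

    module Covering (y : Fin m → V T′) (covers′ : Covers T′ m y) where

      x : Fin m → V T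
      x = contract ∘ toOld ∘ y

      x-burning : IsBurningSeq T m x
      x-burning = covering⇒burning λ z → let (i , d) = covers′ (inject₁ z) in i , project d

      ball-inherited : ∀ K z → DistLe T (radius m K) (x K) z → DistLe T′ (radius m K) (y K) (inject₁ z)
      ball-inherited K z d with covers′ (inject₁ z)
      ... | i , d′ with i ≟ᶠ K
      ...   | yes refl = d′
      ...   | no  i≢K  = ⊥-elim (proj₁ (hyp x x-burning) i K i≢K (z , project d′ , d))

      -- far: reaching d's side from y K in T′ costs one step more than reaching it from x K through d in T.
      beyond-edge : ∀ K {c d} → Adj T c d → ∀ ρ → ρ ≤ radius m K → DistLe T ρ (x K) d →
                    (∀ z t → Side T c d d z → DistGe T t d z → DistGe T′ (suc (ρ + t)) (y K) (inject₁ z)) → ⊥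
      beyond-edge K cd ρ ρ≤r dρ far = far-vertex-or-near-leaf (r ∸ ρ) cd λ
        { (inj₁ (z , sz , dle , dge)) →
            let in-T-ball  = subst (λ q → DistLe T q (x K) z) ρ+t≡r (distLe-trans dρ dle)
                in-T′-ball = ball-inherited K z in-T-ball
            in 1+n≰n (subst (λ q → suc q ≤ r) ρ+t≡r (distGe≤distLe (far z _ sz dge) in-T′-ball))
        ; (inj₂ (ℓ , leaf , _ , j , j<t , w)) →
            <⇒≱ (subst (ρ + j <_) ρ+t≡r (+-monoʳ-< ρ j<t))
              (distGe≤distLe (proj₁ (proj₂ (hyp x x-burning) ℓ leaf) K) (distLe-trans dρ (j , ≤-refl , w)))
        }
        where
        r : ℕ
        r = radius m K
        ρ+t≡r : ρ + (r ∸ ρ) ≡ r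
        ρ+t≡r = m+[n∸m]≡n ρ≤r

      new-source-impossible : ∀ K → toOld (y K) ≡ nothing → ⊥
      new-source-impossible K yK≡new =
        beyond-edge K (Graph.sym T ab) 0 z≤n (subst (λ v → DistLe T 0 v a) (sym (cong contract yK≡new)) distLe-refl) far
        where
        open Oriented {b} {a} (inj₂ (refl , refl))
        far : ∀ z t → Side T b a a z → DistGe T t a z → DistGe T′ (suc t) (y K) (inject₁ z)
        far z t sz dge l w =
          let (l′ , l′<l , w′) = shortcut-new (toSubWalk yK≡new (toOld-inject₁ z) w) sz
          in ≤-trans (s≤s (dge l′ w′)) l′<l

      old-source-impossible : ∀ K {s c d} → toOld (y K) ≡ just s → EdgeEnds a b c d → Side T c d c s →
                              DistLe T′ (radius m K) (y K) new → ⊥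
      old-source-impossible K {s} {c} {d} yK≡s cd-is-ab sc (L , L≤r , P) =
        let (l₀ , l₀<L , w₀) = reach-new (toSubWalk yK≡s (toOld-fromℕ (n T)) P) sc in
        exact-distance (l₀ , ≤-refl , w₀) λ (e , e≤l₀ , de , ge) →
        beyond-edge K cd (suc e) (≤-trans (s≤s e≤l₀) (≤-trans l₀<L L≤r))
          (subst (λ v → DistLe T (suc e) v d) (sym (cong contract yK≡s)) (distLe-∷ʳ de cd))
          λ z t sz dge l w →
            let (l′ , l′<l , w′) = shortcut-old (toSubWalk yK≡s (toOld-inject₁ z) w) sc sz
            in ≤-trans (s≤s (crossing-distGe cd sc sz ge dge l′ w′)) l′<l
        where open Oriented cd-is-ab

      impossible : ⊥
      impossible with covers′ new
      ... | K , reach with toOld (y K) in yK≡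
      ...   | nothing = new-source-impossible K yK≡
      ...   | just s with sides-cover {c = a} {d = b} conn s
      ...     | inj₁ sa = old-source-impossible K yK≡ (inj₁ (refl , refl)) sa reach
      ...     | inj₂ sb = old-source-impossible K yK≡ (inj₂ (refl , refl)) (side-swap sb) reach

    subdivision-not-burnable : ¬ Burnable T′ m
    subdivision-not-burnable (M , M≤m , y , burning) =
      let (y′ , covers′) = covers-pad (≤⇒≤′ M≤m) new (y , proj₁ burning) in Covering.impossible y′ covers′

theorem2p3 : (T : Graph) → IsTree T → (m : ℕ) → BurningNumber T m →
    (∀ (x : Fin m → V T) → IsBurningSeq T m x →
       NonOverlapping T m x × (∀ u → Leaf T u → BurnedInRound T m x u)) →
    MaximallyBurnable T m
theorem2p3 T (_ , conn , acyclic) m burningNumber hyp = burningNumber , λ _ _ arm-or-path i →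
  subdivision-not-burnable ([ (λ arm → proj₂ (proj₁ arm) i) , (λ path → proj₂ (proj₁ path) i) ]′ arm-or-path)
  where open Maximality T conn acyclic m (proj₂ burningNumber) hyp
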